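{- For every $n\geq 1$ and every $k=n,n+1,\ldots,2n-1$, we have $\varphi(F_{2n}(k,k+1))=D_{2n}^{=0}(k)$, $\varphi(S_{2n}(k,k+1))=D_{2n}^{>0}(k+1)$ and $\varphi(L_{2n}(k,k+1))=D_{2n}^{ - }(k)$.
   Context: For $m\geq 0$, $P_m$ is the set of lattice paths in $\mathbb{Z}^2$ starting at $(0,0)$ with $m$ steps, each an upstep $(+1,+1)$ or a downstep $(+1,-1)$. $\varphi$ maps a bitstring $x=(x_1,\ldots,x_m)$ to the path in $P_m$ whose $i$-th step is an upstep if $x_i=1$ and a downstep if $x_i=0$; for a set of bitstrings, $\varphi$ is applied elementwise. For $m\geq 1$ and $k\geq 0$: $D_m(k)$ is the set of paths in $P_m$ with exactly $k$ upsteps that never go below $y=0$; $D_m^{>0}(k)\subseteq D_m(k)$ consists of those having no point $(x,0)$ with $1\leq x\leq m$; $D_m^{=0}(k)\subseteq D_m(k)$ consists of those having at least one point $(x,0)$ with $1\leq x\leq m$; $D_m^{ - }(k)$ is the set of paths in $P_m$ with exactly $k$ upsteps having exactly one point with negative $y$-coordinate, this point being of the form $(x,-1)$, $1\leq x\leq m$. For a set $A$ of bitstrings and a bitstring $y$, $A\circ y$ denotes the set obtained by appending $y$ to every element of $A$. Sets of bitstrings $F_{2n}(k,k+1)$, $S_{2n}(k,k+1)$, $L_{2n}(k,k+1)$ for $n\geq1$, $k=n,\ldots,2n-1$ are defined recursively: $F_2(1,2):=\{(1,0)\}$, $S_2(1,2):=\{(1,1)\}$, $L_2(1,2):=\{(0,1)\}$.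 For $n\geq1$, with the convention that $X_{2n}(2n,2n+1):=\emptyset$ and $X_{2n}(2n+1,2n+2):=\emptyset$ for $X\in\{F,S,L\}$: for $k=n+2,\ldots,2n+1$ and each $X\in\{F,S,L\}$, $X_{2n+2}(k,k+1):=X_{2n}(k,k+1)\circ(0,0)\cup X_{2n}(k-1,k)\circ(1,0)\cup X_{2n}(k-1,k)\circ(0,1)\cup X_{2n}(k-2,k-1)\circ(1,1)$; and $F_{2n+2}(n+1,n+2):=F_{2n}(n+1,n+2)\circ(0,0)\cup F_{2n}(n,n+1)\circ(1,0)\cup S_{2n}(n,n+1)\circ(0,0)$, $S_{2n+2}(n+1,n+2):=S_{2n}(n+1,n+2)\circ(0,0)\cup S_{2n}(n,n+1)\circ(1,0)\cup S_{2n}(n,n+1)\circ(0,1)$, $L_{2n+2}(n+1,n+2):=L_{2n}(n+1,n+2)\circ(0,0)\cup L_{2n}(n,n+1)\circ(1,0)\cup F_{2n}(n,n+1)\circ(0,1)$. -}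

module Defs where

open import Data.Bool using (Bool; true; false; if_then_else_; _∧_)
open import Data.Nat using (ℕ; zero; suc; _∸_; _+_; _*_; _≡ᵇ_; _≤ᵇ_)
open import Data.Integer as ℤ using (ℤ; +_; -[1+_]; _<_; _≤_; _<?_)
open import Data.List using (List; []; _∷_; _++_; map; length; filter)
open import Data.List.Relation.Unary.All using (All)
open import Data.List.Relation.Unary.Any using (Any)
open import Data.List.Membership.Propositional using (_∈_)
open import Data.Product using (Σ; _×_; ∃)
open import Relation.Binary.PropositionalEquality using (_≡_)
open import Relation.Nullary using (¬_)
open import Function.Bundles using (_⇔_)

-- Bitstrings are lists of booleans (true = 1, false = 0).
Bitstring : Set
Bitstring = List Bool

data Step : Set where
  up down : Step

Path : Set
Path = List Step

φ : Bitstring → Path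
φ = map (λ b → if b then up else down)

δ : Step → ℤ
δ up = + 1
δ down = -[1+ 0 ]

-- y-coordinates of the points (1,y_1), …, (m,y_m) of a path started at height h
heightsFrom : ℤ → Path → List ℤ
heightsFrom h [] = []
heightsFrom h (s ∷ p) = (h ℤ.+ δ s) ∷ heightsFrom (h ℤ.+ δ s) p

heights : Path → List ℤ
heights = heightsFrom (+ 0)

ups : Path → ℕ
ups [] = 0
ups (up ∷ p) = suc (ups p)
ups (down ∷ p) = ups p

PathMK : ℕ → ℕ → Path → Set
PathMK m k p = (length p ≡ m) × (ups p ≡ k)

D : ℕ → ℕ → Path → Set
D m k p = PathMK m k p × All (λ y → + 0 ≤ y) (heights p)

D>0 : ℕ → ℕ → Path → Set
D>0 m k p = D m k p × ¬ Any (λ y → y ≡ + 0) (heights p)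

D=0 : ℕ → ℕ → Path → Set
D=0 m k p = D m k p × Any (λ y → y ≡ + 0) (heights p)

D⁻ : ℕ → ℕ → Path → Set
D⁻ m k p = PathMK m k p
         × (length (filter (λ y → y <? + 0) (heights p)) ≡ 1)
         × All (λ y → y < + 0 → y ≡ -[1+ 0 ]) (heights p)

-- A ∘ y : append y to every element of A (finite sets as lists)
_∘ᵇ_ : List Bitstring → Bitstring → List Bitstring
A ∘ᵇ y = map (_++ y) A

b00 b10 b01 b11 : Bitstring
b00 = false ∷ false ∷ []
b10 = true ∷ false ∷ []
b01 = false ∷ true ∷ []
b11 = true ∷ true ∷ []

-- generic recursion step for k = n+2, …, 2n+1 (from family X at level n)
genStep : (ℕ → List Bitstring) → ℕ → List Bitstring
genStep Xn k = (Xn k ∘ᵇ b00) ++ (Xn (k ∸ 1) ∘ᵇ b10) ++ (Xn (k ∸ 1) ∘ᵇ b01)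
             ++ (Xn (k ∸ 2) ∘ᵇ b11)

inGenRange : ℕ → ℕ → Bool
inGenRange n k = (suc (suc n) ≤ᵇ k) ∧ (k ≤ᵇ suc (2 * n))

-- F n k, S n k, L n k  stand for  F_{2n}(k,k+1), S_{2n}(k,k+1), L_{2n}(k,k+1)
-- (the empty set outside the range n ≥ 1, n ≤ k ≤ 2n-1).
F S L : ℕ → ℕ → List Bitstring
F zero k = []
F (suc zero) k = if k ≡ᵇ 1 then (b10 ∷ []) else []
F (suc (suc m)) k =
  if k ≡ᵇ suc (suc m)
  then (F (suc m) k ∘ᵇ b00) ++ (F (suc m) (suc m) ∘ᵇ b10) ++ (S (suc m) (suc m) ∘ᵇ b00)
  else (if inGenRange (suc m) k then genStep (λ j → F (suc m) j) k else [])
S zero k = []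
S (suc zero) k = if k ≡ᵇ 1 then (b11 ∷ []) else []
S (suc (suc m)) k =
  if k ≡ᵇ suc (suc m)
  then (S (suc m) k ∘ᵇ b00) ++ (S (suc m) (suc m) ∘ᵇ b10) ++ (S (suc m) (suc m) ∘ᵇ b01)
  else (if inGenRange (suc m) k then genStep (λ j → S (suc m) j) k else [])
L zero k = []
L (suc zero) k = if k ≡ᵇ 1 then (b01 ∷ []) else []
L (suc (suc m)) k =
  if k ≡ᵇ suc (suc m)
  then (L (suc m) k ∘ᵇ b00) ++ (L (suc m) (suc m) ∘ᵇ b10) ++ (F (suc m) (suc m) ∘ᵇ b01)
  else (if inGenRange (suc m) k then genStep (λ j → L (suc m) j) k else [])

ImageEq : List Bitstring → (Path → Set) → Set
ImageEq A B = ∀ (p : Path) → (∃ λ x → (x ∈ A) × (φ x ≡ p)) ⇔ B p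

module Submission where

-- Write a path by its length, its number of upsteps and its sequence of
-- heights; D^{=0}, D^{>0} and D^{-} are the paths whose heights satisfy a condition
-- CF, CS resp. CL.  We prove, by induction on the level N ≥ 1 and simultaneously for the
-- three families and for ALL k, that F N k, S N k and L N k are exactly the bitstrings whose
-- paths have length 2N, k (resp. k + 1 for S) upsteps and heights satisfying the condition
-- (outside n ≤ k ≤ 2n − 1 both sides are empty, which the recursion needs).
--   A bitstring of length 2N + 2 is y ++ a ∷ b ∷ []; length and upsteps fix the final height
-- d, and the heights are those of y followed by d − δ(b) and d (Profile-snoc).  Below the
-- special value k = N + 1 no path qualifies (it would end too low: dips-too-deep,
-- must-touch-zero); above it d ≥ 2, both new points are positive and the conditions are
-- blind to them (Stable), which is exactly the generic recursion genStep; at k = N + 1 the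
-- four endings ab are inspected directly.

open import Data.Nat using (ℕ; suc; _*_; _≤_; _<_)
open import Data.Product using (_×_)

open import Defs
open import Data.Bool using (Bool; true; false; T; if_then_else_)
open import Data.Bool.Properties using (T-∧)
open import Data.Empty using (⊥; ⊥-elim)
open import Data.Integer as ℤ using (ℤ; +_; -[1+_])
import Data.Integer.Properties as ℤP
import Data.Integer.Tactic.RingSolver as ℤRing
open import Data.List using (List; []; _∷_; _++_; length; filter)
import Data.List.Properties as ListP
open import Data.List.Relation.Unary.All as All using (All; []; _∷_)
import Data.List.Relation.Unary.All.Properties as AllP
open import Data.List.Relation.Unary.Any as Any using (Any; here; there; any?)
import Data.List.Relation.Unary.Any.Properties as AnyP
open import Data.List.Membership.Propositional using (_∈_)
open import Data.List.Membership.Propositional.Properties using (∈-map⁺; ∈-++⁺ˡ; ∈-++⁺ʳ)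
open import Data.Nat as ℕ using (zero; _+_; _∸_; _≡ᵇ_; z≤n; s≤s)
import Data.Nat.Properties as ℕP
import Data.Nat.Tactic.RingSolver as ℕRing
open import Data.Product using (∃-syntax; _,_; proj₁; proj₂)
open import Data.Product.Function.NonDependent.Propositional using (_×-⇔_)
open import Data.Sum using (inj₁; inj₂)
open import Data.Unit using (tt)
open import Function using (_∘_)
open import Function.Bundles using (Equivalence; _⇔_; mk⇔)
import Function.Properties.Equivalence as ⇔
open import Relation.Nullary using (¬_; yes; no)
open import Relation.Binary.Definitions using (tri<; tri≈; tri>)
open import Relation.Binary.PropositionalEquality

open Equivalence using (to; from)

finalFrom : ℤ → Path → ℤ
finalFrom h []      = h
finalFrom h (s ∷ p) = finalFrom (h ℤ.+ δ s) p

final : Path → ℤ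
final = finalFrom (+ 0)

heightsFrom-++ : ∀ h p q →
  heightsFrom h (p ++ q) ≡ heightsFrom h p ++ heightsFrom (finalFrom h p) q
heightsFrom-++ h []      q = refl
heightsFrom-++ h (s ∷ p) q = cong (h ℤ.+ δ s ∷_) (heightsFrom-++ (h ℤ.+ δ s) p q)

finalFrom-++ : ∀ h p q → finalFrom h (p ++ q) ≡ finalFrom (finalFrom h p) q
finalFrom-++ h []      q = refl
finalFrom-++ h (s ∷ p) q = finalFrom-++ (h ℤ.+ δ s) p q

ups-++ : ∀ p q → ups (p ++ q) ≡ ups p + ups q
ups-++ []        q = refl
ups-++ (up ∷ p)   q = cong suc (ups-++ p q)
ups-++ (down ∷ p) q = ups-++ p q

-- Each upstep raises and each downstep lowers the height by one, so
-- final height + length = start height + 2 · upsteps.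
final-value : ∀ h p → finalFrom h p ℤ.+ + length p ≡ h ℤ.+ (+ ups p ℤ.+ + ups p)
final-value h [] = refl
final-value h (up ∷ p) = begin
  finalFrom (h ℤ.+ + 1) p ℤ.+ (+ 1 ℤ.+ + length p)   ≡⟨ shift (finalFrom (h ℤ.+ + 1) p) (+ length p) ⟩
  (finalFrom (h ℤ.+ + 1) p ℤ.+ + length p) ℤ.+ + 1   ≡⟨ cong (ℤ._+ + 1) (final-value (h ℤ.+ + 1) p) ⟩
  ((h ℤ.+ + 1) ℤ.+ (+ ups p ℤ.+ + ups p)) ℤ.+ + 1    ≡⟨ rearrange h (+ ups p) ⟩
  h ℤ.+ ((+ 1 ℤ.+ + ups p) ℤ.+ (+ 1 ℤ.+ + ups p))   ∎
  where
  open ≡-Reasoning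
  shift : ∀ f l → f ℤ.+ (+ 1 ℤ.+ l) ≡ (f ℤ.+ l) ℤ.+ + 1
  shift = ℤRing.solve-∀
  rearrange : ∀ h u → ((h ℤ.+ + 1) ℤ.+ (u ℤ.+ u)) ℤ.+ + 1 ≡ h ℤ.+ ((+ 1 ℤ.+ u) ℤ.+ (+ 1 ℤ.+ u))
  rearrange = ℤRing.solve-∀
final-value h (down ∷ p) = begin
  finalFrom (h ℤ.- + 1) p ℤ.+ (+ 1 ℤ.+ + length p)   ≡⟨ shift (finalFrom (h ℤ.- + 1) p) (+ length p) ⟩
  (finalFrom (h ℤ.- + 1) p ℤ.+ + length p) ℤ.+ + 1   ≡⟨ cong (ℤ._+ + 1) (final-value (h ℤ.- + 1) p) ⟩
  ((h ℤ.- + 1) ℤ.+ (+ ups p ℤ.+ + ups p)) ℤ.+ + 1    ≡⟨ rearrange h (+ ups p) ⟩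
  h ℤ.+ (+ ups p ℤ.+ + ups p)                         ∎
  where
  open ≡-Reasoning
  shift : ∀ f l → f ℤ.+ (+ 1 ℤ.+ l) ≡ (f ℤ.+ l) ℤ.+ + 1
  shift = ℤRing.solve-∀
  rearrange : ∀ h u → ((h ℤ.- + 1) ℤ.+ (u ℤ.+ u)) ℤ.+ + 1 ≡ h ℤ.+ (u ℤ.+ u)
  rearrange = ℤRing.solve-∀

add-sub : ∀ x y → x ≡ (x ℤ.+ y) ℤ.- y
add-sub = ℤRing.solve-∀

final-equation : ∀ {L u} p → PathMK L u p → final p ℤ.+ + L ≡ + (u + u)
final-equation p (refl , refl) = final-value (+ 0) p

final-∈-heights : ∀ {n} p → length p ≡ suc n → final p ∈ heights p
final-∈-heights (s ∷ p) _ = last-point (+ 0) s p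
  where
  last-point : ∀ h s p → finalFrom h (s ∷ p) ∈ heightsFrom h (s ∷ p)
  last-point h s []      = here refl
  last-point h s (t ∷ p) = there (last-point (h ℤ.+ δ s) t p)

final-determined : ∀ {L u d} p → PathMK L u p → L + d ≡ u + u → final p ≡ + d
final-determined {L} {u} {d} p mk L+d≡2u = begin
  final p                      ≡⟨ add-sub (final p) (+ L) ⟩
  (final p ℤ.+ + L) ℤ.- + L    ≡⟨ cong (ℤ._- + L) (final-equation p mk) ⟩
  + (u + u) ℤ.- + L            ≡⟨ cong (λ z → + z ℤ.- + L) (sym (trans (ℕP.+-comm d L) L+d≡2u)) ⟩
  (+ d ℤ.+ + L) ℤ.- + L        ≡⟨ sym (add-sub (+ d) (+ L)) ⟩
  + d                          ∎
  where open ≡-Reasoning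

snoc-heights : ∀ p s t → let q = p ++ s ∷ t ∷ [] in
  heights q ≡ heights p ++ (final q ℤ.- δ t) ∷ final q ∷ []
snoc-heights p s t = begin
  heights (p ++ s ∷ t ∷ [])           ≡⟨ heightsFrom-++ (+ 0) p (s ∷ t ∷ []) ⟩
  heights p ++ x ∷ x ℤ.+ δ t ∷ []     ≡⟨ cong (λ z → heights p ++ z ∷ x ℤ.+ δ t ∷ []) (add-sub x (δ t)) ⟩
  heights p ++ (x ℤ.+ δ t) ℤ.- δ t ∷ x ℤ.+ δ t ∷ []
    ≡⟨ cong (λ z → heights p ++ z ℤ.- δ t ∷ z ∷ []) (sym (finalFrom-++ (+ 0) p (s ∷ t ∷ []))) ⟩
  heights p ++ (final q ℤ.- δ t) ∷ final q ∷ []  ∎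
  where
  open ≡-Reasoning
  q = p ++ s ∷ t ∷ []
  x = final p ℤ.+ δ s

Nonneg HasZero DipsToMinusOne : List ℤ → Set
Nonneg         = All (λ y → + 0 ℤ.≤ y)
HasZero        = Any (_≡ + 0)
DipsToMinusOne = All (λ y → y ℤ.< + 0 → y ≡ -[1+ 0 ])

negCount : List ℤ → ℕ
negCount hs = length (filter (λ y → y ℤ.<? + 0) hs)

CF CS CL : List ℤ → Set
CF hs = Nonneg hs × HasZero hs
CS hs = Nonneg hs × ¬ HasZero hs
CL hs = (negCount hs ≡ 1) × DipsToMinusOne hs

Profile : (List ℤ → Set) → ℕ → ℕ → Path → Set
Profile C m u p = PathMK m u p × C (heights p)

Nonneg⇒DipsToMinusOne : ∀ {hs} → Nonneg hs → DipsToMinusOne hs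
Nonneg⇒DipsToMinusOne = All.map (λ 0≤y y<0 → ⊥-elim (ℤP.≤⇒≯ 0≤y y<0))

negCount-++ : ∀ hs gs → negCount (hs ++ gs) ≡ negCount hs + negCount gs
negCount-++ hs gs = trans (cong length (ListP.filter-++ (ℤ._<? + 0) hs gs)) (ListP.length-++ (filter (ℤ._<? + 0) hs))

negCount≡0⇔Nonneg : ∀ hs → negCount hs ≡ 0 ⇔ Nonneg hs
negCount≡0⇔Nonneg hs = mk⇔ (to′ hs) (from′ hs)
  where
  to′ : ∀ hs → negCount hs ≡ 0 → Nonneg hs
  to′ []       _  = []
  to′ (y ∷ hs) eq with y ℤ.<? + 0
  ... | yes _   = ⊥-elim (ℕP.1+n≢0 eq)
  ... | no  y≮0 = ℤP.≮⇒≥ y≮0 ∷ to′ hs eq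
  from′ : ∀ hs → Nonneg hs → negCount hs ≡ 0
  from′ []       []         = refl
  from′ (y ∷ hs) (0≤y ∷ nn) with y ℤ.<? + 0
  ... | yes y<0 = ⊥-elim (ℤP.≤⇒≯ 0≤y y<0)
  ... | no  _   = from′ hs nn

Nonneg-++ : ∀ hs a b → Nonneg hs ⇔ Nonneg (hs ++ + a ∷ + b ∷ [])
Nonneg-++ hs a b = mk⇔ (λ nn → AllP.++⁺ nn (ℤ.+≤+ z≤n ∷ ℤ.+≤+ z≤n ∷ [])) (AllP.++⁻ˡ hs)

HasZero-++ : ∀ hs a b → HasZero hs ⇔ HasZero (hs ++ + suc a ∷ + suc b ∷ [])
HasZero-++ hs a b = mk⇔ AnyP.++⁺ˡ drop-positive
  where
  drop-positive : HasZero (hs ++ + suc a ∷ + suc b ∷ []) → HasZero hs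
  drop-positive z with AnyP.++⁻ hs z
  ... | inj₁ z′                  = z′
  ... | inj₂ (here ())
  ... | inj₂ (there (here ()))

CL-++ : ∀ hs a b → CL hs ⇔ CL (hs ++ + a ∷ + b ∷ [])
CL-++ hs a b = mk⇔
  (λ (c , dips) → trans (negCount-++ hs _) (trans (ℕP.+-identityʳ _) c)
                , AllP.++⁺ dips ((λ { (ℤ.+<+ ()) }) ∷ (λ { (ℤ.+<+ ()) }) ∷ []))
  (λ (c , dips) → trans (sym (trans (negCount-++ hs _) (ℕP.+-identityʳ _))) c
                , AllP.++⁻ˡ hs dips)

Stable : (List ℤ → Set) → Set
Stable C = ∀ hs a b → C hs ⇔ C (hs ++ + suc a ∷ + suc b ∷ [])

CF-stable : Stable CF
CF-stable hs a b = Nonneg-++ hs (suc a) (suc b) ×-⇔ HasZero-++ hs a b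

CS-stable : Stable CS
CS-stable hs a b = Nonneg-++ hs (suc a) (suc b)
  ×-⇔ mk⇔ (λ nz → nz ∘ from (HasZero-++ hs a b)) (λ nz → nz ∘ to (HasZero-++ hs a b))

CL-stable : Stable CL
CL-stable hs a b = CL-++ hs (suc a) (suc b)

step : Bool → Step
step b = if b then up else down

-- when a path ends at height ≥ 2, its last two points are both positive
stable-above-two : ∀ {C} → Stable C → ∀ hs c b →
  C hs ⇔ C (hs ++ (+ suc (suc c) ℤ.- δ (step b)) ∷ + suc (suc c) ∷ [])
stable-above-two stable hs c false = stable hs (suc (c + 1)) (suc c)
stable-above-two stable hs c true  = stable hs c (suc c)

split-last-two : ∀ (x : Bitstring) → 2 ≤ length x → ∃[ y ] ∃[ a ] ∃[ b ] x ≡ y ++ a ∷ b ∷ []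
split-last-two (_ ∷ [])              (s≤s ())
split-last-two (a ∷ b ∷ [])          _ = [] , a , b , refl
split-last-two (c ∷ x@(_ ∷ _ ∷ _))   _ with split-last-two x (s≤s (s≤s z≤n))
... | y , a , b , x≡ = c ∷ y , a , b , cong (c ∷_) x≡

bits-ups≤2 : ∀ a b → ups (φ (a ∷ b ∷ [])) ≤ 2
bits-ups≤2 false false = z≤n
bits-ups≤2 false true  = s≤s z≤n
bits-ups≤2 true  false = s≤s z≤n
bits-ups≤2 true  true  = ℕP.≤-refl

-- If the extended path has length M = L + 2 and u upsteps,
-- its final height d is forced (M + d = 2u); its profile is then that of the
-- prefix (with u minus the new upsteps) followed by the heights d - δ t and d.
Profile-snoc : ∀ {C M L u d} y a b → M ≡ L + 2 → M + d ≡ u + u → 2 ≤ u →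
  Profile C M u (φ (y ++ a ∷ b ∷ [])) ⇔
  (PathMK L (u ∸ ups (φ (a ∷ b ∷ []))) (φ y) × C (heights (φ y) ++ (+ d ℤ.- δ (step b)) ∷ + d ∷ []))
Profile-snoc {C} {M} {L} {u} {d} y a b M≡L+2 M+d≡2u 2≤u
  rewrite ListP.map-++ step y (a ∷ b ∷ []) = mk⇔
    (λ ((lq , kq) , c) → (length-prefix lq , ups-prefix kq) , subst C (last-two (lq , kq)) c)
    (λ ((lp , kp) , c) → (length-whole lp , ups-whole kp) ,
                          subst C (sym (last-two (length-whole lp , ups-whole kp))) c)
  where
  p = φ y
  tail = step a ∷ step b ∷ []
  v = ups tail
  length-prefix : length (p ++ tail) ≡ M → length p ≡ L
  length-prefix lq = ℕP.+-cancelʳ-≡ 2 _ _ (trans (sym (ListP.length-++ p)) (trans lq M≡L+2))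
  length-whole : length p ≡ L → length (p ++ tail) ≡ M
  length-whole lp = trans (ListP.length-++ p) (trans (cong (_+ 2) lp) (sym M≡L+2))
  ups-prefix : ups (p ++ tail) ≡ u → ups p ≡ u ∸ v
  ups-prefix kq = trans (sym (ℕP.m+n∸n≡m (ups p) v)) (cong (_∸ v) (trans (sym (ups-++ p tail)) kq))
  ups-whole : ups p ≡ u ∸ v → ups (p ++ tail) ≡ u
  ups-whole kp = trans (ups-++ p tail)
                   (trans (cong (_+ v) kp) (ℕP.m∸n+n≡m (ℕP.≤-trans (bits-ups≤2 a b) 2≤u)))
  last-two : PathMK M u (p ++ tail) → heights (p ++ tail) ≡ heights p ++ (+ d ℤ.- δ (step b)) ∷ + d ∷ []
  last-two mk = trans (snoc-heights p (step a) (step b))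
    (cong (λ z → heights p ++ (z ℤ.- δ (step b)) ∷ z ∷ []) (final-determined (p ++ tail) mk M+d≡2u))

if-T : ∀ {A : Set} b {x y : A} → T b → (if b then x else y) ≡ x
if-T true _ = refl

if-¬T : ∀ {A : Set} b {x y : A} → ¬ T b → (if b then x else y) ≡ y
if-¬T false _   = refl
if-¬T true  ¬tt = ⊥-elim (¬tt tt)

branch : ℕ → List Bitstring → (ℕ → List Bitstring) → ℕ → List Bitstring
branch n A X k = if k ≡ᵇ suc n then A else (if inGenRange n k then genStep X k else [])

module _ (n : ℕ) (A : List Bitstring) (X : ℕ → List Bitstring) where

  branch-at : branch n A X (suc n) ≡ A
  branch-at = if-T (suc n ≡ᵇ suc n) (ℕP.≡⇒≡ᵇ (suc n) (suc n) refl)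

  private
    not-special : ∀ {k} → k ≢ suc n → branch n A X k ≡ (if inGenRange n k then genStep X k else [])
    not-special {k} k≢ = if-¬T (k ≡ᵇ suc n) (k≢ ∘ ℕP.≡ᵇ⇒≡ k (suc n))

  branch-below : ∀ k → k < suc n → branch n A X k ≡ []
  branch-below k k<1+n = trans (not-special (ℕP.<⇒≢ k<1+n))
    (if-¬T (inGenRange n k) (λ t → ℕP.<⇒≱ k<1+n
      (ℕP.≤-trans (ℕP.n≤1+n _) (ℕP.≤ᵇ⇒≤ (suc (suc n)) k (proj₁ (to T-∧ t))))))

  branch-beyond : ∀ k → suc (2 * n) < k → branch n A X k ≡ []
  branch-beyond k big =
    trans (not-special (λ k≡ → ℕP.<⇒≱ big (ℕP.≤-trans (ℕP.≤-reflexive k≡) (s≤s (ℕP.m≤m+n n _)))))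
    (if-¬T (inGenRange n k) (λ t → ℕP.<⇒≱ big (ℕP.≤ᵇ⇒≤ k (suc (2 * n)) (proj₂ (to T-∧ t)))))

  branch-above : ∀ k → suc (suc n) ≤ k → k ≤ suc (2 * n) → branch n A X k ≡ genStep X k
  branch-above k low high = trans (not-special (λ k≡ → ℕP.<⇒≢ low (sym k≡)))
    (if-T (inGenRange n k) (from T-∧ (ℕP.≤⇒≤ᵇ low , ℕP.≤⇒≤ᵇ high)))

genStep-vanish : ∀ (X : ℕ → List Bitstring) k →
  X k ≡ [] → X (k ∸ 1) ≡ [] → X (k ∸ 2) ≡ [] → genStep X k ≡ []
genStep-vanish X k e₀ e₁ e₂ rewrite e₀ | e₁ | e₂ = refl

record Recursive (X : ℕ → ℕ → List Bitstring) : Set where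
  field
    seed    : Bitstring
    special : ℕ → ℕ → List Bitstring
    unfold₁ : ∀ k → X 1 k ≡ (if k ≡ᵇ 1 then seed ∷ [] else [])
    unfold  : ∀ m k → X (suc (suc m)) k ≡ branch (suc m) (special m k) (X (suc m)) k

  vanish : ∀ m j → 2 * suc m ≤ j → X (suc m) j ≡ []
  vanish zero    j 2≤j     = trans (unfold₁ j) (if-¬T (j ≡ᵇ 1) λ t → ℕP.<⇒≢ 2≤j (sym (ℕP.≡ᵇ⇒≡ j 1 t)))
  vanish (suc m) j 2N+2≤j = trans (unfold m j) (branch-beyond (suc m) (special m j) (X (suc m)) j
    (ℕP.≤-trans (ℕP.≤-reflexive (level-grows m)) 2N+2≤j))
    where
    level-grows : ∀ m → suc (suc (2 * suc m)) ≡ 2 * suc (suc m)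
    level-grows = ℕRing.solve-∀

  unfold-below : ∀ m k → k < suc (suc m) → X (suc (suc m)) k ≡ []
  unfold-below m k k< = trans (unfold m k) (branch-below (suc m) (special m k) (X (suc m)) k k<)

  unfold-at : ∀ m → X (suc (suc m)) (suc (suc m)) ≡ special m (suc (suc m))
  unfold-at m = trans (unfold m _) (branch-at (suc m) (special m (suc (suc m))) (X (suc m)))

  -- beyond the special value, X is genStep — also where both sides are empty
  unfold-above : ∀ m k → suc (suc (suc m)) ≤ k → X (suc (suc m)) k ≡ genStep (X (suc m)) k
  unfold-above m k low with k ℕ.≤? suc (2 * suc m)
  ... | yes high = trans (unfold m k) (branch-above (suc m) (special m k) (X (suc m)) k low high)
  ... | no  high = begin
    X (suc (suc m)) k  ≡⟨ unfold m k ⟩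
    branch (suc m) (special m k) (X (suc m)) k  ≡⟨ branch-beyond (suc m) (special m k) (X (suc m)) k big ⟩
    []                 ≡⟨ genStep-vanish (X (suc m)) k
                            (vanish m k (ℕP.<⇒≤ (ℕP.<-trans (ℕP.n<1+n _) big)))
                            (vanish m (k ∸ 1) (ℕP.<⇒≤ (ℕP.∸-monoˡ-≤ 1 big)))
                            (vanish m (k ∸ 2) (ℕP.∸-monoˡ-≤ 2 big)) ⟨
    genStep (X (suc m)) k  ∎
    where
    open ≡-Reasoning
    big = ℕP.≰⇒> high

F-recursive : Recursive F
F-recursive = record
  { seed    = b10
  ; special = λ m k → (F (suc m) k ∘ᵇ b00) ++ (F (suc m) (suc m) ∘ᵇ b10) ++ (S (suc m) (suc m) ∘ᵇ b00)
  ; unfold₁ = λ _ → refl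
  ; unfold  = λ _ _ → refl
  }

S-recursive : Recursive S
S-recursive = record
  { seed    = b11
  ; special = λ m k → (S (suc m) k ∘ᵇ b00) ++ (S (suc m) (suc m) ∘ᵇ b10) ++ (S (suc m) (suc m) ∘ᵇ b01)
  ; unfold₁ = λ _ → refl
  ; unfold  = λ _ _ → refl
  }

L-recursive : Recursive L
L-recursive = record
  { seed    = b01
  ; special = λ m k → (L (suc m) k ∘ᵇ b00) ++ (L (suc m) (suc m) ∘ᵇ b10) ++ (F (suc m) (suc m) ∘ᵇ b01)
  ; unfold₁ = λ _ → refl
  ; unfold  = λ _ _ → refl
  }

double-suc : ∀ N → 2 * suc N ≡ 2 * N + 2
double-suc = ℕRing.solve-∀

Profile-snoc-stable : ∀ {C N u} c → Stable C → 2 * suc N + suc (suc c) ≡ u + u → 2 ≤ u → ∀ y a b →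
  Profile C (2 * suc N) u (φ (y ++ a ∷ b ∷ [])) ⇔ Profile C (2 * N) (u ∸ ups (φ (a ∷ b ∷ []))) (φ y)
Profile-snoc-stable {C} {N} c stable final-eq 2≤u y a b =
  ⇔.trans (Profile-snoc {C} y a b (double-suc N) final-eq 2≤u) (⇔.refl ×-⇔ ⇔.sym (stable-above-two stable _ c b))

two≤length : ∀ {N} x → length (φ x) ≡ 2 * suc N → 2 ≤ length x
two≤length {N} x lx = subst (2 ≤_) (trans (sym (double-suc N)) (trans (sym lx) (ListP.length-map step x)))
                        (ℕP.m≤n+m 2 (2 * N))

complete-by-last-two : ∀ {A : List Bitstring} {C N u} →
  (∀ y a b → Profile C (2 * suc N) u (φ (y ++ a ∷ b ∷ [])) → y ++ a ∷ b ∷ [] ∈ A) →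
  ∀ x → Profile C (2 * suc N) u (φ x) → x ∈ A
complete-by-last-two cases x pr@((lx , _) , _) with split-last-two x (two≤length x lx)
... | y , a , b , refl = cases y a b pr

∈-∘ᵇ : ∀ {A : List Bitstring} {y} s → y ∈ A → y ++ s ∈ A ∘ᵇ s
∈-∘ᵇ s = ∈-map⁺ (_++ s)

genStep-All : ∀ {P : Bitstring → Set} X k →
  (∀ a b → All (P ∘ (_++ a ∷ b ∷ [])) (X (k ∸ ups (φ (a ∷ b ∷ []))))) → All P (genStep X k)
genStep-All X k blocks = AllP.++⁺ (AllP.map⁺ (blocks false false)) (AllP.++⁺ (AllP.map⁺ (blocks true false))
                           (AllP.++⁺ (AllP.map⁺ (blocks false true)) (AllP.map⁺ (blocks true true))))

genStep-∈ : ∀ X k a b {y} → y ∈ X (k ∸ ups (φ (a ∷ b ∷ []))) → y ++ a ∷ b ∷ [] ∈ genStep X k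
genStep-∈ X k false false y∈ = ∈-++⁺ˡ (∈-∘ᵇ b00 y∈)
genStep-∈ X k true  false y∈ = ∈-++⁺ʳ (X k ∘ᵇ b00) (∈-++⁺ˡ (∈-∘ᵇ b10 y∈))
genStep-∈ X k false true  y∈ =
  ∈-++⁺ʳ (X k ∘ᵇ b00) (∈-++⁺ʳ (X (k ∸ 1) ∘ᵇ b10) (∈-++⁺ˡ (∈-∘ᵇ b01 y∈)))
genStep-∈ X k true  true  y∈ =
  ∈-++⁺ʳ (X k ∘ᵇ b00) (∈-++⁺ʳ (X (k ∸ 1) ∘ᵇ b10) (∈-++⁺ʳ (X (k ∸ 1) ∘ᵇ b01) (∈-∘ᵇ b11 y∈)))

Exact : List Bitstring → (List ℤ → Set) → ℕ → ℕ → Set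
Exact A C M u = All (λ x → Profile C M u (φ x)) A × (∀ x → Profile C M u (φ x) → x ∈ A)

Represents : (ℕ → List Bitstring) → (List ℤ → Set) → ℕ → ℕ → Set
Represents X C e N = ∀ k → Exact (X k) C (2 * N) (e + k)

record Level (N : ℕ) : Set where
  field
    F-exact : Represents (F N) CF 0 N
    S-exact : Represents (S N) CS 1 N
    L-exact : Represents (L N) CL 0 N

double : ∀ N → N + N ≡ 2 * N
double = ℕRing.solve-∀

-- fewer than N upsteps out of 2N: the path ends at height ≤ −2
double-< : ∀ {k N} → k < N → suc (k + k) < 2 * N
double-< {k} {N} k<N = subst₂ _≤_ (suc+suc k) (double N) (ℕP.+-mono-≤ k<N k<N)
  where
  suc+suc : ∀ k → suc k + suc k ≡ suc (suc (k + k))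
  suc+suc = ℕRing.solve-∀

-- ... so it cannot have −1 as its only negative height.
dips-too-deep : ∀ {n k} p → k < suc n → PathMK (2 * suc n) k p → ¬ DipsToMinusOne (heights p)
dips-too-deep {n} {k} p k<N mk dips = ends-at (final p) refl
  where
  end-equation : ∀ {h} → final p ≡ h → h ℤ.+ + (2 * suc n) ≡ + (k + k)
  end-equation f≡ = trans (cong (ℤ._+ + (2 * suc n)) (sym f≡)) (final-equation p mk)
  ends-at : ∀ h → final p ≡ h → ⊥
  ends-at (+ c) f≡ = ℕP.<⇒≱ (ℕP.<-trans (ℕP.n<1+n _) (double-< k<N))
    (ℕP.≤-trans (ℕP.m≤n+m _ c) (ℕP.≤-reflexive (ℤP.+-injective (end-equation f≡))))
  ends-at -[1+ zero ] f≡ = ℕP.<⇒≢ (double-< k<N) (sym (cong suc (ℤP.+-injective (end-equation f≡))))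
  ends-at -[1+ suc j ] f≡
    with All.lookup dips (final-∈-heights p (proj₁ mk)) (subst (ℤ._< + 0) (sym f≡) ℤ.-<+)
  ... | f≡-1 with trans (sym f≡) f≡-1
  ... | ()

-- At most N upsteps out of 2N: a path that stays at height ≥ 0 must end at 0.
must-touch-zero : ∀ {n k} p → k ≤ suc n → PathMK (2 * suc n) k p → Nonneg (heights p) → HasZero (heights p)
must-touch-zero {n} {k} p k≤N mk nn = ends-at (final p) refl
  where
  last∈ : final p ∈ heights p
  last∈ = final-∈-heights p (proj₁ mk)
  ends-at : ∀ h → final p ≡ h → HasZero (heights p)
  ends-at (+ zero) f≡ = Any.map (λ e → trans (sym e) f≡) last∈
  ends-at (+ suc c) f≡ = ⊥-elim (ℕP.<⇒≱ (ℕP.m<n+m (2 * suc n) (s≤s z≤n))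
    (subst (_≤ 2 * suc n) (sym (ℤP.+-injective (trans (cong (ℤ._+ + (2 * suc n)) (sym f≡)) (final-equation p mk))))
      (subst (k + k ≤_) (double (suc n)) (ℕP.+-mono-≤ k≤N k≤N))))
  ends-at -[1+ j ] f≡ with subst (+ 0 ℤ.≤_) f≡ (All.lookup nn last∈)
  ... | ()

singleton-represents : ∀ {C e} w → Profile C 2 (e + 1) (φ w) →
  (∀ k x → Profile C 2 (e + k) (φ x) → k ≡ 1 × x ≡ w) →
  Represents (λ k → if k ≡ᵇ 1 then w ∷ [] else []) C e 1
singleton-represents {C} {e} w w-profile unique k = sound , complete
  where
  sound : All (λ x → Profile C 2 (e + k) (φ x)) (if k ≡ᵇ 1 then w ∷ [] else [])
  sound with k ≡ᵇ 1 in k≡ᵇ1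
  ... | false = []
  ... | true with ℕP.≡ᵇ⇒≡ k 1 (subst T (sym k≡ᵇ1) tt)
  ...   | refl = w-profile ∷ []
  complete : ∀ x → Profile C 2 (e + k) (φ x) → x ∈ (if k ≡ᵇ 1 then w ∷ [] else [])
  complete x pr with unique k x pr
  ... | refl , refl = here refl

F₁-unique : ∀ k x → Profile CF 2 k (φ x) → k ≡ 1 × x ≡ b10
F₁-unique k (true ∷ false ∷ [])  ((_ , refl) , _)     = refl , refl
F₁-unique k (false ∷ _ ∷ [])     (_ , (() ∷ _) , _)
F₁-unique k (true ∷ true ∷ [])   (_ , _ , here ())
F₁-unique k (true ∷ true ∷ [])   (_ , _ , there (here ()))
F₁-unique k (true ∷ true ∷ [])   (_ , _ , there (there ()))
F₁-unique k []                   ((() , _) , _)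
F₁-unique k (_ ∷ [])             ((() , _) , _)
F₁-unique k (_ ∷ _ ∷ _ ∷ _)      ((() , _) , _)

S₁-unique : ∀ k x → Profile CS 2 (suc k) (φ x) → k ≡ 1 × x ≡ b11
S₁-unique k (true ∷ true ∷ [])   ((_ , refl) , _)     = refl , refl
S₁-unique k (false ∷ _ ∷ [])     (_ , (() ∷ _) , _)
S₁-unique k (true ∷ false ∷ [])  (_ , _ , no-zero)    = ⊥-elim (no-zero (there (here refl)))
S₁-unique k []                   ((() , _) , _)
S₁-unique k (_ ∷ [])             ((() , _) , _)
S₁-unique k (_ ∷ _ ∷ _ ∷ _)      ((() , _) , _)

L₁-unique : ∀ k x → Profile CL 2 k (φ x) → k ≡ 1 × x ≡ b01
L₁-unique k (false ∷ true ∷ [])  ((_ , refl) , _)     = refl , refl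
L₁-unique k (false ∷ false ∷ []) (_ , () , _)
L₁-unique k (true ∷ false ∷ [])  (_ , () , _)
L₁-unique k (true ∷ true ∷ [])   (_ , () , _)
L₁-unique k []                   ((() , _) , _)
L₁-unique k (_ ∷ [])             ((() , _) , _)
L₁-unique k (_ ∷ _ ∷ _ ∷ _)      ((() , _) , _)

level-one : Level 1
level-one = record
  { F-exact = singleton-represents {CF} {0} b10 ((refl , refl) , nonneg , there (here refl)) F₁-unique
  ; S-exact = singleton-represents {CS} {1} b11 ((refl , refl) , nonneg , no-zero) S₁-unique
  ; L-exact = singleton-represents {CL} {0} b01 ((refl , refl) , refl , ((λ _ → refl) ∷ (λ { (ℤ.+<+ ()) }) ∷ [])) L₁-unique
  }
  where
  nonneg : ∀ {a b} → Nonneg (+ a ∷ + b ∷ [])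
  nonneg = ℤ.+≤+ z≤n ∷ ℤ.+≤+ z≤n ∷ []
  no-zero : ¬ HasZero (+ 1 ∷ + 2 ∷ [])
  no-zero (here ())
  no-zero (there (here ()))

-- Generic step, k = N + 2 + t at level N + 1: the path ends at height 2(e + t + 1) ≥ 2,
-- so by stability x ++ ab is exact iff x is exact for k − #upsteps(ab) at level N.
generic-step : ∀ {X C e N} → Stable C → Represents X C e N →
  ∀ t → Exact (genStep X (suc (suc N) + t)) C (2 * suc N) (e + (suc (suc N) + t))
generic-step {X} {C} {e} {N} stable exact t =
    genStep-All X k (λ a b → All.map (from (snoc _ a b) ∘ shift-ups a b) (proj₁ (exact (k ∸ v a b))))
  , complete-by-last-two {C = C}
      (λ y a b pr → genStep-∈ X k a b (proj₂ (exact _) y (unshift-ups a b (to (snoc y a b) pr))))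
  where
  k = suc (suc N) + t
  v : Bool → Bool → ℕ
  v a b = ups (φ (a ∷ b ∷ []))
  end-equation : ∀ N t e → 2 * suc N + suc (suc (t + t + (e + e))) ≡ (e + (suc (suc N) + t)) + (e + (suc (suc N) + t))
  end-equation = ℕRing.solve-∀
  snoc : ∀ y a b →
    Profile C (2 * suc N) (e + k) (φ (y ++ a ∷ b ∷ [])) ⇔ Profile C (2 * N) ((e + k) ∸ v a b) (φ y)
  snoc = Profile-snoc-stable {C} {N} {e + k} (t + t + (e + e)) stable (end-equation N t e)
           (ℕP.≤-trans (s≤s (s≤s z≤n)) (ℕP.m≤n+m k e))
  ups-assoc : ∀ a b → (e + k) ∸ v a b ≡ e + (k ∸ v a b)
  ups-assoc a b = ℕP.+-∸-assoc e (ℕP.≤-trans (bits-ups≤2 a b) (s≤s (s≤s z≤n)))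
  shift-ups : ∀ a b {y} → Profile C (2 * N) (e + (k ∸ v a b)) y → Profile C (2 * N) ((e + k) ∸ v a b) y
  shift-ups a b ((ly , ky) , c) = (ly , trans ky (sym (ups-assoc a b))) , c
  unshift-ups : ∀ a b {y} → Profile C (2 * N) ((e + k) ∸ v a b) y → Profile C (2 * N) (e + (k ∸ v a b)) y
  unshift-ups a b ((ly , ky) , c) = (ly , trans ky (ups-assoc a b)) , c

Nonneg⇔CL-dip : ∀ hs → Nonneg hs ⇔ CL (hs ++ -[1+ 0 ] ∷ + 0 ∷ [])
Nonneg⇔CL-dip hs = mk⇔
  (λ nn → trans (negCount-++ hs _) (cong (_+ 1) (from (negCount≡0⇔Nonneg hs) nn))
        , AllP.++⁺ (Nonneg⇒DipsToMinusOne nn) ((λ _ → refl) ∷ (λ { (ℤ.+<+ ()) }) ∷ []))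
  (λ (count≡1 , _) → to (negCount≡0⇔Nonneg hs)
        (ℕP.+-cancelʳ-≡ 1 _ 0 (trans (sym (negCount-++ hs (-[1+ 0 ] ∷ + 0 ∷ []))) count≡1)))

-- The special value k = N + 1 at level N + 1 (with N ≥ 1), where the path returns to
-- height 0 (F, L) or 2 (S) and the last two steps are read off case by case.
module Special (m : ℕ) (level : Level (suc m)) where
  open Level level
  N = suc m

  F-next S-next L-next : List Bitstring
  F-next = (F N (suc N) ∘ᵇ b00) ++ (F N N ∘ᵇ b10) ++ (S N N ∘ᵇ b00)
  S-next = (S N (suc N) ∘ᵇ b00) ++ (S N N ∘ᵇ b10) ++ (S N N ∘ᵇ b01)
  L-next = (L N (suc N) ∘ᵇ b00) ++ (L N N ∘ᵇ b10) ++ (F N N ∘ᵇ b01)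

  -- with N + 1 (F, L) resp. N + 2 (S) upsteps out of 2N + 2 the path ends at 0 resp. 2
  ends-at-0 : ∀ n → 2 * suc n + 0 ≡ suc n + suc n
  ends-at-0 = ℕRing.solve-∀

  ends-at-2 : ∀ n → 2 * suc n + 2 ≡ suc (suc n) + suc (suc n)
  ends-at-2 = ℕRing.solve-∀

  -- F: the last two points are (1, 0); the prefix ends at 2 (ending 00) or at 0 (ending 10),
  -- and in the first case it touches 0 (F) or not (S).
  F-special : Exact F-next CF (2 * suc N) (suc N)
  F-special = AllP.++⁺ (AllP.map⁺ (All.map (λ (mk , nn , _) → extend false mk nn) (proj₁ (F-exact (suc N)))))
             (AllP.++⁺ (AllP.map⁺ (All.map (λ (mk , nn , _) → extend true mk nn) (proj₁ (F-exact N))))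
                       (AllP.map⁺ (All.map (λ (mk , nn , _) → extend false mk nn) (proj₁ (S-exact N)))))
            , complete-by-last-two {C = CF} {N} cases
    where
    snoc : ∀ y a b → Profile CF (2 * suc N) (suc N) (φ (y ++ a ∷ b ∷ [])) ⇔
      (PathMK (2 * N) (suc N ∸ ups (φ (a ∷ b ∷ []))) (φ y) × CF (heights (φ y) ++ (+ 0 ℤ.- δ (step b)) ∷ + 0 ∷ []))
    snoc y a b = Profile-snoc {CF} {2 * suc N} {2 * N} {suc N} {0} y a b (double-suc N) (ends-at-0 N) (s≤s (s≤s z≤n))
    extend : ∀ a {y} → PathMK (2 * N) (suc N ∸ ups (φ (a ∷ false ∷ []))) (φ y) → Nonneg (heights (φ y)) →
      Profile CF (2 * suc N) (suc N) (φ (y ++ a ∷ false ∷ []))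
    extend a {y} mk nn =
      from (snoc y a false) (mk , to (Nonneg-++ _ 1 0) nn , AnyP.++⁺ʳ (heights (φ y)) (there (here refl)))
    cases : ∀ y a b → Profile CF (2 * suc N) (suc N) (φ (y ++ a ∷ b ∷ [])) → y ++ a ∷ b ∷ [] ∈ F-next
    cases y a true pr with to (snoc y a true) pr
    ... | _ , nn , _ with AllP.++⁻ʳ (heights (φ y)) nn
    ...   | () ∷ _
    cases y false false pr with to (snoc y false false) pr
    ... | mk , nn , _ with any? (ℤ._≟ + 0) (heights (φ y))
    ...   | yes touches = ∈-++⁺ˡ (∈-∘ᵇ b00
                            (proj₂ (F-exact (suc N)) y (mk , from (Nonneg-++ _ 1 0) nn , touches)))
    ...   | no  ¬touches = ∈-++⁺ʳ (F N (suc N) ∘ᵇ b00) (∈-++⁺ʳ (F N N ∘ᵇ b10)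
                          (∈-∘ᵇ b00 (proj₂ (S-exact N) y (mk , from (Nonneg-++ _ 1 0) nn , ¬touches))))
    cases y true false pr with to (snoc y true false) pr
    ... | mk , nn , _ = ∈-++⁺ʳ (F N (suc N) ∘ᵇ b00) (∈-++⁺ˡ (∈-∘ᵇ b10
          (proj₂ (F-exact N) y (mk , nn′ , must-touch-zero (φ y) ℕP.≤-refl mk nn′))))
      where nn′ = from (Nonneg-++ _ 1 0) nn

  -- S: the path ends at 2 and its last two points are positive; the ending 11 would make
  -- the prefix end at 0, which S forbids.
  S-special : Exact S-next CS (2 * suc N) (suc (suc N))
  S-special = AllP.++⁺ (AllP.map⁺ (All.map (from (snoc _ false false)) (proj₁ (S-exact (suc N)))))
             (AllP.++⁺ (AllP.map⁺ (All.map (from (snoc _ true false)) (proj₁ (S-exact N))))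
                       (AllP.map⁺ (All.map (from (snoc _ false true)) (proj₁ (S-exact N)))))
            , complete-by-last-two {C = CS} {N} cases
    where
    snoc : ∀ y a b → Profile CS (2 * suc N) (suc (suc N)) (φ (y ++ a ∷ b ∷ [])) ⇔
      Profile CS (2 * N) (suc (suc N) ∸ ups (φ (a ∷ b ∷ []))) (φ y)
    snoc = Profile-snoc-stable {CS} {N} {suc (suc N)} 0 CS-stable (ends-at-2 N) (s≤s (s≤s z≤n))
    cases : ∀ y a b → Profile CS (2 * suc N) (suc (suc N)) (φ (y ++ a ∷ b ∷ [])) → y ++ a ∷ b ∷ [] ∈ S-next
    cases y false false pr = ∈-++⁺ˡ (∈-∘ᵇ b00 (proj₂ (S-exact (suc N)) y (to (snoc y false false) pr)))
    cases y true  false pr = ∈-++⁺ʳ (S N (suc N) ∘ᵇ b00) (∈-++⁺ˡ (∈-∘ᵇ b10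
                               (proj₂ (S-exact N) y (to (snoc y true false) pr))))
    cases y false true  pr = ∈-++⁺ʳ (S N (suc N) ∘ᵇ b00) (∈-++⁺ʳ (S N N ∘ᵇ b10) (∈-∘ᵇ b01
                               (proj₂ (S-exact N) y (to (snoc y false true) pr))))
    cases y true  true  pr with to (snoc y true true) pr
    ... | mk , nn , ¬zero = ⊥-elim (¬zero (must-touch-zero (φ y) ℕP.≤-refl mk nn))

  -- L: the last two points are (1, 0) or (−1, 0).  After (1, 0) the condition passes to the
  -- prefix; after (−1, 0) the prefix is non-negative and ends at 0 (F), and the ending 11
  -- would make it end at −2.
  L-special : Exact L-next CL (2 * suc N) (suc N)
  L-special = AllP.++⁺ (AllP.map⁺ (All.map (λ (mk , c) → from (snoc _ false false) (mk , to (CL-++ _ 1 0) c))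
                                           (proj₁ (L-exact (suc N)))))
             (AllP.++⁺ (AllP.map⁺ (All.map (λ (mk , c) → from (snoc _ true false) (mk , to (CL-++ _ 1 0) c))
                                           (proj₁ (L-exact N))))
                       (AllP.map⁺ (All.map (λ (mk , nn , _) → from (snoc _ false true) (mk , to (Nonneg⇔CL-dip _) nn))
                                           (proj₁ (F-exact N)))))
            , complete-by-last-two {C = CL} {N} cases
    where
    snoc : ∀ y a b → Profile CL (2 * suc N) (suc N) (φ (y ++ a ∷ b ∷ [])) ⇔
      (PathMK (2 * N) (suc N ∸ ups (φ (a ∷ b ∷ []))) (φ y) × CL (heights (φ y) ++ (+ 0 ℤ.- δ (step b)) ∷ + 0 ∷ []))
    snoc y a b = Profile-snoc {CL} {2 * suc N} {2 * N} {suc N} {0} y a b (double-suc N) (ends-at-0 N) (s≤s (s≤s z≤n))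
    cases : ∀ y a b → Profile CL (2 * suc N) (suc N) (φ (y ++ a ∷ b ∷ [])) → y ++ a ∷ b ∷ [] ∈ L-next
    cases y false false pr with to (snoc y false false) pr
    ... | mk , c = ∈-++⁺ˡ (∈-∘ᵇ b00 (proj₂ (L-exact (suc N)) y (mk , from (CL-++ _ 1 0) c)))
    cases y true false pr with to (snoc y true false) pr
    ... | mk , c = ∈-++⁺ʳ (L N (suc N) ∘ᵇ b00) (∈-++⁺ˡ (∈-∘ᵇ b10
          (proj₂ (L-exact N) y (mk , from (CL-++ _ 1 0) c))))
    cases y false true pr with to (snoc y false true) pr
    ... | mk , c = ∈-++⁺ʳ (L N (suc N) ∘ᵇ b00) (∈-++⁺ʳ (L N N ∘ᵇ b10) (∈-∘ᵇ b01
          (proj₂ (F-exact N) y (mk , nn , must-touch-zero (φ y) ℕP.≤-refl mk nn))))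
      where nn = from (Nonneg⇔CL-dip _) c
    cases y true true pr with to (snoc y true true) pr
    ... | mk , _ , dips = ⊥-elim (dips-too-deep (φ y) (ℕP.n<1+n m) mk (AllP.++⁻ˡ (heights (φ y)) dips))

data Position (n : ℕ) : ℕ → Set where
  below : ∀ {k} → k < n → Position n k
  at    : Position n n
  above : ∀ t → Position n (suc n + t)

position : ∀ n k → Position n k
position n k with ℕP.<-cmp k n
... | tri< k<n _ _  = below k<n
... | tri≈ _ refl _ = at
... | tri> _ _ n<k  = subst (Position n) (ℕP.m+[n∸m]≡n n<k) (above (k ∸ suc n))

level-step : ∀ {X C e} (rec : Recursive X) → Stable C → ∀ m →
  (∀ k p → k < suc (suc m) → ¬ Profile C (2 * suc (suc m)) (e + k) p) →
  Exact (Recursive.special rec m (suc (suc m))) C (2 * suc (suc m)) (e + suc (suc m)) →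
  Represents (X (suc m)) C e (suc m) → Represents (X (suc (suc m))) C e (suc (suc m))
level-step {X} {C} {e} rec stable m too-low special-exact exact k with position (suc (suc m)) k
... | below k< = subst (λ A → Exact A C _ _) (sym (Recursive.unfold-below rec m k k<))
                   ([] , λ x pr → ⊥-elim (too-low k (φ x) k< pr))
... | at       = subst (λ A → Exact A C _ _) (sym (Recursive.unfold-at rec m)) special-exact
... | above t  = subst (λ A → Exact A C _ _) (sym (Recursive.unfold-above rec m _ (ℕP.m≤m+n _ t)))
                   (generic-step stable exact t)

F-too-low : ∀ {n} k p → k < suc n → ¬ Profile CF (2 * suc n) k p
F-too-low k p k< (mk , nn , _) = dips-too-deep p k< mk (Nonneg⇒DipsToMinusOne nn)

S-too-low : ∀ {n} k p → k < suc n → ¬ Profile CS (2 * suc n) (suc k) p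
S-too-low k p k< (mk , nn , ¬zero) = ¬zero (must-touch-zero p k< mk nn)

L-too-low : ∀ {n} k p → k < suc n → ¬ Profile CL (2 * suc n) k p
L-too-low k p k< (mk , _ , dips) = dips-too-deep p k< mk dips

all-levels : ∀ m → Level (suc m)
all-levels zero    = level-one
all-levels (suc m) = record
  { F-exact = level-step F-recursive CF-stable m F-too-low F-special F-exact
  ; S-exact = level-step S-recursive CS-stable m S-too-low S-special S-exact
  ; L-exact = level-step L-recursive CL-stable m L-too-low L-special L-exact
  }
  where
  open Level (all-levels m)
  open Special m (all-levels m)

ψ : Path → Bitstring
ψ []         = []
ψ (up ∷ p)   = true ∷ ψ p
ψ (down ∷ p) = false ∷ ψ p

φ∘ψ : ∀ p → φ (ψ p) ≡ p
φ∘ψ []         = refl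
φ∘ψ (up ∷ p)   = cong (up ∷_) (φ∘ψ p)
φ∘ψ (down ∷ p) = cong (down ∷_) (φ∘ψ p)

exact⇒image : ∀ {A C M u} {B : Path → Set} → Exact A C M u → (∀ p → Profile C M u p ⇔ B p) → ImageEq A B
exact⇒image {A} {C} {M} {u} (sound , complete) conv p = mk⇔
  (λ { (x , x∈A , refl) → to (conv (φ x)) (All.lookup sound x∈A) })
  (λ bp → ψ p , complete (ψ p) (subst (Profile C M u) (sym (φ∘ψ p)) (from (conv p) bp)) , φ∘ψ p)

-- D^{=0} and D^{>0} are the profiles for CF and CS, bracketed differently
reassoc : ∀ {A B D : Set} → (A × B × D) ⇔ ((A × B) × D)
reassoc = mk⇔ (λ (a , b , d) → (a , b) , d) (λ ((a , b) , d) → a , b , d)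

-- The identities hold for every k.
lemma10 : ∀ (n k : ℕ) → 1 ≤ n → n ≤ k → k < 2 * n →
    ImageEq (F n k) (D=0 (2 * n) k)
    × ImageEq (S n k) (D>0 (2 * n) (suc k))
    × ImageEq (L n k) (D⁻ (2 * n) k)
lemma10 (suc m) k _ _ _ =
    exact⇒image {C = CF} (F-exact k) (λ _ → reassoc)
  , exact⇒image {C = CS} (S-exact k) (λ _ → reassoc)
  , exact⇒image {C = CL} (L-exact k) (λ _ → ⇔.refl)
  where open Level (all-levels m)
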